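{- Let $n\ge 0$, $k\in\mathbb{Z}$ and $a\in\mathbb{C}$ with $a\neq0$. Then \[ PC_{n}^{(k)}(x:a)=a^{ -n}\sum_{j=0}^{n}\left\{\sum_{m=j}^{n}\sum_{l=0}^{n-m}(-1)^{l+j}\binom{n}{l}\binom{m}{j}\frac{a^{l}}{(m-j+1)^{k}}\,S_{1}(n-l,m)\right\}x^{j}. \]
   Context: For an integer $k$, $\mathrm{Lif}_k(t)=\sum_{n=0}^{\infty}\frac{t^{n}}{n!\,(n+1)^{k}}$. For $a\neq0$, $PC_n^{(k)}(x:a)$ is defined by $e^{ -t}\,\mathrm{Lif}_k\!\left(\log\left(1+\frac{t}{a}\right)\right)\left(1+\frac{t}{a}\right)^{ -x}=\sum_{n\ge0}PC_n^{(k)}(x:a)\frac{t^n}{n!}$. $S_1(n,l)$ denotes the (signed) Stirling numbers of the first kind, defined by $x(x-1)\cdots(x-n+1)=\sum_{l=0}^{n}S_1(n,l)x^l$. -}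

module Defs where

open import Level using (Level)
open import Data.Nat as ℕ using (ℕ; zero; suc; _∸_)
open import Data.Nat.Combinatorics using (_C_)
open import Data.Integer as ℤ using (ℤ; +_; -[1+_])
open import Algebra.Bundles using (CommutativeRing)
open import Relation.Nullary using (yes; no)

-- Signed Stirling numbers of the first kind:
-- x(x-1)...(x-n+1) = Σ_l S1 n l x^l
S1 : ℕ → ℕ → ℤ
S1 zero zero = + 1
S1 zero (suc l) = + 0
S1 (suc n) zero = + 0
S1 (suc n) (suc l) = S1 n l ℤ.- (+ n) ℤ.* S1 n (suc l)

-- All constructions below take place in a commutative ring R together with
-- a function inv such that inv m is an inverse of the integer (m+1) in R
-- (i.e. R is a ℚ-algebra, e.g. R = ℂ).
module Setup {c ℓ : Level} (R : CommutativeRing c ℓ) (inv : ℕ → CommutativeRing.Carrier R) where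
  open CommutativeRing R

  natR : ℕ → Carrier
  natR zero = 0#
  natR (suc n) = 1# + natR n

  intR : ℤ → Carrier
  intR (+ n) = natR n
  intR -[1+ n ] = - natR (suc n)

  pow : Carrier → ℕ → Carrier
  pow y zero = 1#
  pow y (suc n) = y * pow y n

  sgn : ℕ → Carrier
  sgn zero = 1#
  sgn (suc n) = - sgn n

  sumTo : ℕ → (ℕ → Carrier) → Carrier
  sumTo zero f = f 0
  sumTo (suc n) f = sumTo n f + f (suc n)

  sumFromTo : ℕ → ℕ → (ℕ → Carrier) → Carrier
  sumFromTo j n f with n ℕ.<? j
  ... | yes _ = 0#
  ... | no _ = sumTo (n ∸ j) (λ i → f (j ℕ.+ i))

  invFact : ℕ → Carrier
  invFact zero = 1#
  invFact (suc n) = inv n * invFact n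

  -- 1 / (b+1)^k   for k ∈ ℤ
  invPowZ : ℕ → ℤ → Carrier
  invPowZ b (+ n) = pow (inv b) n
  invPowZ b -[1+ n ] = pow (natR (suc b)) (suc n)

  fall : Carrier → ℕ → Carrier
  fall y zero = 1#
  fall y (suc n) = fall y n * (y - natR n)

  -- Formal power series in t, given by coefficient functions (coefficient of t^N).
  PS : Set c
  PS = ℕ → Carrier

  _⊛_ : PS → PS → PS
  (f ⊛ g) N = sumTo N (λ i → f i * g (N ∸ i))

  onePS : PS
  onePS zero = 1#
  onePS (suc _) = 0#

  powPS : PS → ℕ → PS
  powPS f zero = onePS
  powPS f (suc n) = f ⊛ powPS f n

  expNeg : PS
  expNeg N = sgn N * invFact N

  -- log(1 + t/a), with ainv = a⁻¹ :  Σ_{m≥1} (-1)^{m-1} (t/a)^m / m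
  log1p : Carrier → PS
  log1p ainv zero = 0#
  log1p ainv (suc m) = sgn m * inv m * pow ainv (suc m)

  -- Lif_k(g(t)) for a series g with zero constant term:
  -- Σ_n g(t)^n / (n! (n+1)^k)   (coefficient of t^N only involves n ≤ N)
  LifComp : ℤ → PS → PS
  LifComp k g N = sumTo N (λ n → powPS g n N * invFact n * invPowZ n k)

  -- (1 + t/a)^{-x} = Σ_N binom(-x, N) (t/a)^N
  binomNeg : Carrier → Carrier → PS
  binomNeg ainv x N = fall (- x) N * invFact N * pow ainv N

  -- PC_n^{(k)}(x:a) = n! · [t^n] e^{-t} Lif_k(log(1+t/a)) (1+t/a)^{-x}
  PC : ℤ → Carrier → ℕ → Carrier → Carrier
  PC k ainv n x = natR (n ℕ.!) * ((expNeg ⊛ LifComp k (log1p ainv)) ⊛ binomNeg ainv x) n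

  RHS : ℤ → Carrier → Carrier → ℕ → Carrier → Carrier
  RHS k a ainv n x =
    pow ainv n * sumTo n (λ j →
      sumFromTo j n (λ m → sumTo (n ∸ m) (λ l →
        sgn (l ℕ.+ j) * natR (n C l) * natR (m C j) * pow a l * invPowZ (m ∸ j) k
          * intR (S1 (n ∸ l) m)))
      * pow x j)

module Submission where

-- Write L = log(1 + t/a) and θ = t d/dt.  From θL^{m+1} = (m+1) θL · L^m and
-- (1 + t/a) θL = t/a one gets L^m/m! = Σ_N S1(N,m) (t/a)^N / N!, and expanding the
-- falling factorial in Stirling numbers gives (1 + t/a)^{-x} = exp(-x L).  Hence
-- Lif_k(L) (1 + t/a)^{-x} = Σ_M (L^M/M!) Σ_j C(M,j) (-x)^j / (M-j+1)^k, and
-- multiplying by e^{-t} turns the coefficient of t^n into a binomial convolution in n,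
-- which is the stated double sum.

open import Defs
open import Level using (Level)
open import Data.Nat as ℕ using (ℕ; zero; suc; _∸_; _≤_; _<_; z≤n; s≤s)
import Data.Nat.Properties as ℕP
open import Data.Nat.Combinatorics using (_C_; nCk≡n!/k![n-k]!; k![n∸k]!∣n!; k>n⇒nCk≡0)
open import Data.Nat.DivMod using (m/n*n≡m)
open import Data.Integer as ℤ using (ℤ; +_; -[1+_])
import Data.Integer.Properties as ℤP
open import Data.Maybe using (Maybe; just; nothing)
open import Data.Sum using (inj₁; inj₂)
open import Relation.Nullary using (yes; no)
open import Relation.Binary.PropositionalEquality as P using (_≡_)
open import Algebra.Bundles using (CommutativeRing)
open import Algebra.Solver.Ring.AlmostCommutativeRing using (fromCommutativeRing; _-Raw-AlmostCommutative⟶_)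
import Algebra.Solver.Ring

module Embedding {c ℓ : Level} (R : CommutativeRing c ℓ) (inv : ℕ → CommutativeRing.Carrier R) where
  open CommutativeRing R
  open Setup R inv
  open import Relation.Binary.Reasoning.Setoid setoid
  open import Algebra.Definitions.RawMonoid +-rawMonoid using (_×_)
  open import Algebra.Properties.Monoid.Mult +-monoid using (×-homo-+)
  open import Algebra.Properties.Semiring.Mult semiring using (×1-homo-*)
  open import Algebra.Properties.Group +-group using (ε⁻¹≈ε; ⁻¹-involutive; //-rightDividesʳ)
  open import Algebra.Properties.AbelianGroup +-abelianGroup using (⁻¹-∙-comm; ⁻¹-anti-homo‿-)
  open import Algebra.Properties.Ring ring using (-‿distribˡ-*; -‿distribʳ-*)

  ≡⇒≈ : ∀ {x y} → x ≡ y → x ≈ y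
  ≡⇒≈ P.refl = refl

  natR≈×1# : ∀ n → natR n ≈ n × 1#
  natR≈×1# zero = refl
  natR≈×1# (suc n) = +-congˡ (natR≈×1# n)

  natR-+ : ∀ m n → natR (m ℕ.+ n) ≈ natR m + natR n
  natR-+ m n = begin
    natR (m ℕ.+ n)        ≈⟨ natR≈×1# (m ℕ.+ n) ⟩
    (m ℕ.+ n) × 1#        ≈⟨ ×-homo-+ 1# m n ⟩
    m × 1# + n × 1#       ≈⟨ sym (+-cong (natR≈×1# m) (natR≈×1# n)) ⟩
    natR m + natR n       ∎

  natR-* : ∀ m n → natR (m ℕ.* n) ≈ natR m * natR n
  natR-* m n = begin
    natR (m ℕ.* n)        ≈⟨ natR≈×1# (m ℕ.* n) ⟩
    (m ℕ.* n) × 1#        ≈⟨ ×1-homo-* m n ⟩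
    m × 1# * n × 1#       ≈⟨ sym (*-cong (natR≈×1# m) (natR≈×1# n)) ⟩
    natR m * natR n       ∎

  natR-∸ : ∀ {m n} → n ≤ m → natR (m ∸ n) ≈ natR m - natR n
  natR-∸ {m} {n} n≤m = begin
    natR (m ∸ n)                     ≈⟨ sym (//-rightDividesʳ (natR n) (natR (m ∸ n))) ⟩
    (natR (m ∸ n) + natR n) - natR n ≈⟨ +-congʳ (sym (natR-+ (m ∸ n) n)) ⟩
    natR (m ∸ n ℕ.+ n) - natR n      ≈⟨ +-congʳ (≡⇒≈ (P.cong natR (ℕP.m∸n+n≡m n≤m))) ⟩
    natR m - natR n                  ∎

  intR-neg : ∀ i → intR (ℤ.- i) ≈ - intR i
  intR-neg (+ zero) = sym ε⁻¹≈ε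
  intR-neg (+ suc n) = refl
  intR-neg -[1+ n ] = sym (⁻¹-involutive _)

  intR-⊖ : ∀ m n → intR (m ℤ.⊖ n) ≈ natR m - natR n
  intR-⊖ m n with ℕP.≤-<-connex n m
  ... | inj₁ n≤m = trans (≡⇒≈ (P.cong intR (ℤP.⊖-≥ n≤m))) (natR-∸ n≤m)
  ... | inj₂ m<n = begin
    intR (m ℤ.⊖ n)          ≈⟨ ≡⇒≈ (P.cong intR (ℤP.⊖-< m<n)) ⟩
    intR (ℤ.- (+ (n ∸ m)))  ≈⟨ intR-neg (+ (n ∸ m)) ⟩
    - natR (n ∸ m)          ≈⟨ -‿cong (natR-∸ (ℕP.<⇒≤ m<n)) ⟩
    - (natR n - natR m)     ≈⟨ ⁻¹-anti-homo‿- (natR n) (natR m) ⟩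
    natR m - natR n         ∎

  intR-+ : ∀ i j → intR (i ℤ.+ j) ≈ intR i + intR j
  intR-+ -[1+ m ] -[1+ n ] = begin
    - natR (suc (suc (m ℕ.+ n)))    ≈⟨ -‿cong (≡⇒≈ (P.cong natR (P.sym (ℕP.+-suc (suc m) n)))) ⟩
    - natR (suc m ℕ.+ suc n)        ≈⟨ -‿cong (natR-+ (suc m) (suc n)) ⟩
    - (natR (suc m) + natR (suc n)) ≈⟨ sym (⁻¹-∙-comm _ _) ⟩
    - natR (suc m) + - natR (suc n) ∎
  intR-+ -[1+ m ] (+ n) = trans (intR-⊖ n (suc m)) (+-comm _ _)
  intR-+ (+ m) -[1+ n ] = intR-⊖ m (suc n)
  intR-+ (+ m) (+ n) = natR-+ m n

  intR-+* : ∀ m j → intR (+ m ℤ.* j) ≈ natR m * intR j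
  intR-+* m (+ n) = trans (≡⇒≈ (P.cong intR (P.sym (ℤP.pos-* m n)))) (natR-* m n)
  intR-+* m -[1+ n ] = begin
    intR (+ m ℤ.* -[1+ n ])          ≈⟨ ≡⇒≈ (P.cong intR (P.sym (ℤP.neg-distribʳ-* (+ m) (+ suc n)))) ⟩
    intR (ℤ.- (+ m ℤ.* + suc n))     ≈⟨ intR-neg (+ m ℤ.* + suc n) ⟩
    - intR (+ m ℤ.* + suc n)         ≈⟨ -‿cong (intR-+* m (+ suc n)) ⟩
    - (natR m * natR (suc n))        ≈⟨ -‿distribʳ-* _ _ ⟩
    natR m * - natR (suc n)          ∎

  intR-* : ∀ i j → intR (i ℤ.* j) ≈ intR i * intR j
  intR-* (+ m) j = intR-+* m j
  intR-* -[1+ m ] j = begin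
    intR (-[1+ m ] ℤ.* j)            ≈⟨ ≡⇒≈ (P.cong intR (P.sym (ℤP.neg-distribˡ-* (+ suc m) j))) ⟩
    intR (ℤ.- (+ suc m ℤ.* j))       ≈⟨ intR-neg (+ suc m ℤ.* j) ⟩
    - intR (+ suc m ℤ.* j)           ≈⟨ -‿cong (intR-+* (suc m) j) ⟩
    - (natR (suc m) * intR j)        ≈⟨ -‿distribˡ-* _ _ ⟩
    - natR (suc m) * intR j          ∎

  intR-homomorphism : ℤ.+-*-rawRing -Raw-AlmostCommutative⟶ fromCommutativeRing R
  intR-homomorphism = record
    { ⟦_⟧    = intR
    ; +-homo = intR-+
    ; *-homo = intR-*
    ; -‿homo = intR-neg
    ; 0-homo = refl
    ; 1-homo = +-identityʳ 1#
    }

  intR-≟ : ∀ i j → Maybe (intR i ≈ intR j)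
  intR-≟ i j with i ℤ.≟ j
  ... | yes P.refl = just refl
  ... | no _ = nothing

  module Solver = Algebra.Solver.Ring ℤ.+-*-rawRing (fromCommutativeRing R) intR-homomorphism intR-≟

module Sums {c ℓ : Level} (R : CommutativeRing c ℓ) (inv : ℕ → CommutativeRing.Carrier R) where
  open CommutativeRing R
  open Setup R inv
  open Embedding R inv using (≡⇒≈)
  open import Relation.Binary.Reasoning.Setoid setoid
  open import Algebra.Properties.CommutativeSemigroup +-commutativeSemigroup using (interchange)
  open import Algebra.Properties.AbelianGroup +-abelianGroup using (⁻¹-∙-comm)

  sumTo-cong : ∀ n {f g} → (∀ i → f i ≈ g i) → sumTo n f ≈ sumTo n g
  sumTo-cong zero e = e 0
  sumTo-cong (suc n) e = +-cong (sumTo-cong n e) (e (suc n))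

  sumTo-cong-≤ : ∀ n {f g} → (∀ i → i ≤ n → f i ≈ g i) → sumTo n f ≈ sumTo n g
  sumTo-cong-≤ zero e = e 0 z≤n
  sumTo-cong-≤ (suc n) e = +-cong (sumTo-cong-≤ n (λ i i≤n → e i (ℕP.m≤n⇒m≤1+n i≤n))) (e (suc n) ℕP.≤-refl)

  sumTo-zero : ∀ n {f} → (∀ i → i ≤ n → f i ≈ 0#) → sumTo n f ≈ 0#
  sumTo-zero n e = trans (sumTo-cong-≤ n e) (sumTo-0# n)
    where
    sumTo-0# : ∀ n → sumTo n (λ _ → 0#) ≈ 0#
    sumTo-0# zero = refl
    sumTo-0# (suc n) = trans (+-identityʳ _) (sumTo-0# n)

  sumTo-+ : ∀ n f g → sumTo n (λ i → f i + g i) ≈ sumTo n f + sumTo n g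
  sumTo-+ zero f g = refl
  sumTo-+ (suc n) f g = trans (+-congʳ (sumTo-+ n f g)) (interchange _ _ _ _)

  *-distribˡ-sumTo : ∀ n x f → x * sumTo n f ≈ sumTo n (λ i → x * f i)
  *-distribˡ-sumTo zero x f = refl
  *-distribˡ-sumTo (suc n) x f = trans (distribˡ _ _ _) (+-congʳ (*-distribˡ-sumTo n x f))

  *-distribʳ-sumTo : ∀ n x f → sumTo n f * x ≈ sumTo n (λ i → f i * x)
  *-distribʳ-sumTo zero x f = refl
  *-distribʳ-sumTo (suc n) x f = trans (distribʳ _ _ _) (+-congʳ (*-distribʳ-sumTo n x f))

  -‿sumTo : ∀ n f → - sumTo n f ≈ sumTo n (λ i → - f i)
  -‿sumTo zero f = refl
  -‿sumTo (suc n) f = trans (sym (⁻¹-∙-comm _ _)) (+-congʳ (-‿sumTo n f))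

  sumTo-suc : ∀ n f → sumTo (suc n) f ≈ f 0 + sumTo n (λ i → f (suc i))
  sumTo-suc zero f = refl
  sumTo-suc (suc n) f = trans (+-congʳ (sumTo-suc n f)) (+-assoc _ _ _)

  sumTo-head : ∀ n f → (∀ i → f (suc i) ≈ 0#) → sumTo n f ≈ f 0
  sumTo-head zero f e = refl
  sumTo-head (suc n) f e = trans (+-cong (sumTo-head n f e) (e n)) (+-identityʳ _)

  sumTo-swap : ∀ n m (F : ℕ → ℕ → Carrier) →
               sumTo n (λ i → sumTo m (λ j → F i j)) ≈ sumTo m (λ j → sumTo n (λ i → F i j))
  sumTo-swap zero m F = refl
  sumTo-swap (suc n) m F = begin
    sumTo n (λ i → sumTo m (F i)) + sumTo m (F (suc n))           ≈⟨ +-congʳ (sumTo-swap n m F) ⟩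
    sumTo m (λ j → sumTo n (λ i → F i j)) + sumTo m (F (suc n))   ≈⟨ sym (sumTo-+ m _ _) ⟩
    sumTo m (λ j → sumTo n (λ i → F i j) + F (suc n) j)           ∎

  sumTo-reverse : ∀ n f → sumTo n (λ i → f (n ∸ i)) ≈ sumTo n f
  sumTo-reverse zero f = refl
  sumTo-reverse (suc n) f = begin
    sumTo (suc n) (λ i → f (suc n ∸ i))   ≈⟨ sumTo-suc n _ ⟩
    f (suc n) + sumTo n (λ i → f (n ∸ i)) ≈⟨ +-congˡ (sumTo-reverse n f) ⟩
    f (suc n) + sumTo n f                 ≈⟨ +-comm _ _ ⟩
    sumTo n f + f (suc n)                 ∎

  sumTo-extend : ∀ m n f → m ≤ n → (∀ i → m < i → i ≤ n → f i ≈ 0#) → sumTo n f ≈ sumTo m f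
  sumTo-extend zero zero f z≤n e = refl
  sumTo-extend m (suc n) f m≤1+n e with ℕP.m≤n⇒m<n∨m≡n m≤1+n
  ... | inj₂ P.refl = refl
  ... | inj₁ (s≤s m≤n) = begin
    sumTo n f + f (suc n) ≈⟨ +-cong (sumTo-extend m n f m≤n (λ i m<i i≤n → e i m<i (ℕP.m≤n⇒m≤1+n i≤n)))
                                    (e (suc n) (s≤s m≤n) ℕP.≤-refl) ⟩
    sumTo m f + 0#        ≈⟨ +-identityʳ _ ⟩
    sumTo m f             ∎

  sumTo-triangle : ∀ N (F : ℕ → ℕ → Carrier) →
                   sumTo N (λ i → sumTo i (λ j → F j i)) ≈ sumTo N (λ j → sumTo (N ∸ j) (λ p → F j (j ℕ.+ p)))
  sumTo-triangle zero F = refl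
  sumTo-triangle (suc N) F = begin
    sumTo N (λ i → sumTo i (λ j → F j i)) + sumTo (suc N) (λ j → F j (suc N))
      ≈⟨ +-congʳ (sumTo-triangle N F) ⟩
    sumTo N (λ j → sumTo (N ∸ j) (λ p → F j (j ℕ.+ p))) + (sumTo N (λ j → F j (suc N)) + F (suc N) (suc N))
      ≈⟨ sym (+-assoc _ _ _) ⟩
    (sumTo N (λ j → sumTo (N ∸ j) (λ p → F j (j ℕ.+ p))) + sumTo N (λ j → F j (suc N))) + F (suc N) (suc N)
      ≈⟨ +-cong (sym (sumTo-+ N _ _)) (≡⇒≈ (P.cong (F (suc N)) (P.sym (ℕP.+-identityʳ (suc N))))) ⟩
    sumTo N (λ j → sumTo (N ∸ j) (λ p → F j (j ℕ.+ p)) + F j (suc N)) + F (suc N) (suc N ℕ.+ 0)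
      ≈⟨ +-cong (sumTo-cong-≤ N column) (≡⇒≈ (P.cong (λ k → sumTo k (λ p → F (suc N) (suc N ℕ.+ p))) (P.sym (ℕP.n∸n≡0 N)))) ⟩
    sumTo N (λ j → sumTo (suc N ∸ j) (λ p → F j (j ℕ.+ p))) + sumTo (suc N ∸ suc N) (λ p → F (suc N) (suc N ℕ.+ p)) ∎
    where
    column : ∀ j → j ≤ N → sumTo (N ∸ j) (λ p → F j (j ℕ.+ p)) + F j (suc N) ≈ sumTo (suc N ∸ j) (λ p → F j (j ℕ.+ p))
    column j j≤N = begin
      sumTo (N ∸ j) (λ p → F j (j ℕ.+ p)) + F j (suc N)  ≈⟨ +-congˡ (≡⇒≈ (P.cong (F j) (P.sym j+[1+N∸j]≡1+N))) ⟩
      sumTo (suc (N ∸ j)) (λ p → F j (j ℕ.+ p))          ≈⟨ ≡⇒≈ (P.cong (λ k → sumTo k (λ p → F j (j ℕ.+ p))) (P.sym (ℕP.+-∸-assoc 1 j≤N))) ⟩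
      sumTo (suc N ∸ j) (λ p → F j (j ℕ.+ p))            ∎
      where
      j+[1+N∸j]≡1+N : j ℕ.+ suc (N ∸ j) ≡ suc N
      j+[1+N∸j]≡1+N = P.trans (ℕP.+-suc j (N ∸ j)) (P.cong suc (ℕP.m+[n∸m]≡n j≤N))

  sumTo-antidiagonal : ∀ N (F : ℕ → ℕ → Carrier) → (∀ m i → i ≤ N → N ∸ i < m → F m i ≈ 0#) →
                       sumTo N (λ m → sumTo N (λ i → F m i)) ≈ sumTo N (λ M → sumTo M (λ j → F (M ∸ j) j))
  sumTo-antidiagonal N F vanish = begin
    sumTo N (λ m → sumTo N (λ i → F m i))
      ≈⟨ sumTo-swap N N F ⟩
    sumTo N (λ i → sumTo N (λ m → F m i))
      ≈⟨ sumTo-cong-≤ N (λ i i≤N → sumTo-extend (N ∸ i) N _ (ℕP.m∸n≤m N i) (λ m lt _ → vanish m i i≤N lt)) ⟩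
    sumTo N (λ i → sumTo (N ∸ i) (λ m → F m i))
      ≈⟨ sumTo-cong N (λ i → sumTo-cong (N ∸ i) (λ m → ≡⇒≈ (P.cong (λ z → F z i) (P.sym (ℕP.m+n∸m≡n i m))))) ⟩
    sumTo N (λ j → sumTo (N ∸ j) (λ p → F ((j ℕ.+ p) ∸ j) j))
      ≈⟨ sym (sumTo-triangle N (λ j M → F (M ∸ j) j)) ⟩
    sumTo N (λ M → sumTo M (λ j → F (M ∸ j) j)) ∎

  sumFromTo≈sumTo : ∀ j n f → (∀ m → m < j → f m ≈ 0#) → sumFromTo j n f ≈ sumTo n f
  sumFromTo≈sumTo j n f vanish with n ℕ.<? j
  ... | yes n<j = sym (sumTo-zero n (λ i i≤n → vanish i (ℕP.≤-<-trans i≤n n<j)))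
  ... | no n≮j = sym (begin
    sumTo n f               ≈⟨ ≡⇒≈ (P.cong (λ z → sumTo z f) (P.sym (ℕP.m+[n∸m]≡n j≤n))) ⟩
    sumTo (j ℕ.+ (n ∸ j)) f ≈⟨ dropInitial j (n ∸ j) f vanish ⟩
    sumTo (n ∸ j) (λ i → f (j ℕ.+ i)) ∎)
    where
    j≤n : j ≤ n
    j≤n = ℕP.≮⇒≥ n≮j
    dropInitial : ∀ j d g → (∀ m → m < j → g m ≈ 0#) → sumTo (j ℕ.+ d) g ≈ sumTo d (λ i → g (j ℕ.+ i))
    dropInitial zero d g e = refl
    dropInitial (suc j) d g e = begin
      sumTo (suc (j ℕ.+ d)) g                     ≈⟨ sumTo-suc (j ℕ.+ d) g ⟩
      g 0 + sumTo (j ℕ.+ d) (λ i → g (suc i))     ≈⟨ +-cong (e 0 (s≤s z≤n)) (dropInitial j d (λ i → g (suc i)) (λ m m<j → e (suc m) (s≤s m<j))) ⟩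
      0# + sumTo d (λ i → g (suc (j ℕ.+ i)))      ≈⟨ +-identityˡ _ ⟩
      sumTo d (λ i → g (suc j ℕ.+ i))             ∎

  sumTo-swap₃ : ∀ n (F : ℕ → ℕ → ℕ → Carrier) →
                sumTo n (λ l → sumTo n (λ m → sumTo n (λ j → F l m j)))
                ≈ sumTo n (λ j → sumTo n (λ m → sumTo n (λ l → F l m j)))
  sumTo-swap₃ n F = begin
    sumTo n (λ l → sumTo n (λ m → sumTo n (λ j → F l m j))) ≈⟨ sumTo-cong n (λ l → sumTo-swap n n _) ⟩
    sumTo n (λ l → sumTo n (λ j → sumTo n (λ m → F l m j))) ≈⟨ sumTo-swap n n _ ⟩
    sumTo n (λ j → sumTo n (λ l → sumTo n (λ m → F l m j))) ≈⟨ sumTo-cong n (λ j → sumTo-swap n n _) ⟩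
    sumTo n (λ j → sumTo n (λ m → sumTo n (λ l → F l m j))) ∎

module Series {c ℓ : Level} (R : CommutativeRing c ℓ) (inv : ℕ → CommutativeRing.Carrier R) where
  open CommutativeRing R
  open Setup R inv
  open Embedding R inv using (≡⇒≈; natR-+; module Solver)
  open Solver using (solve; _:+_; _:*_; _:=_)
  open Sums R inv
  open import Relation.Binary.Reasoning.Setoid setoid
  open import Algebra.Properties.CommutativeSemigroup *-commutativeSemigroup using (x∙yz≈y∙xz)

  infix 4 _≋_
  _≋_ : PS → PS → Set ℓ
  f ≋ g = ∀ N → f N ≈ g N

  infixr 7 _·_
  _·_ : Carrier → PS → PS
  (x · f) N = x * f N

  θ : PS → PS
  θ f N = natR N * f N

  ⊛-cong : ∀ {f g f′ g′} → f ≋ g → f′ ≋ g′ → f ⊛ f′ ≋ g ⊛ g′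
  ⊛-cong e e′ N = sumTo-cong N (λ i → *-cong (e i) (e′ (N ∸ i)))

  ⊛-congˡ : ∀ f {g g′} → g ≋ g′ → f ⊛ g ≋ f ⊛ g′
  ⊛-congˡ f = ⊛-cong {f} {f} (λ _ → refl)

  ⊛-comm : ∀ f g → f ⊛ g ≋ g ⊛ f
  ⊛-comm f g N = begin
    sumTo N (λ i → f i * g (N ∸ i))               ≈⟨ sym (sumTo-reverse N _) ⟩
    sumTo N (λ i → f (N ∸ i) * g (N ∸ (N ∸ i)))   ≈⟨ sumTo-cong-≤ N (λ i i≤N → trans (*-comm _ _) (*-congʳ (≡⇒≈ (P.cong g (ℕP.m∸[m∸n]≡n i≤N))))) ⟩
    sumTo N (λ i → g i * f (N ∸ i))               ∎

  ⊛-assoc : ∀ f g h → (f ⊛ g) ⊛ h ≋ f ⊛ (g ⊛ h)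
  ⊛-assoc f g h N = begin
    sumTo N (λ i → sumTo i (λ j → f j * g (i ∸ j)) * h (N ∸ i))
      ≈⟨ sumTo-cong N (λ i → *-distribʳ-sumTo i _ _) ⟩
    sumTo N (λ i → sumTo i (λ j → f j * g (i ∸ j) * h (N ∸ i)))
      ≈⟨ sumTo-triangle N (λ j i → f j * g (i ∸ j) * h (N ∸ i)) ⟩
    sumTo N (λ j → sumTo (N ∸ j) (λ p → f j * g (j ℕ.+ p ∸ j) * h (N ∸ (j ℕ.+ p))))
      ≈⟨ sumTo-cong N (λ j → trans (sumTo-cong (N ∸ j) (λ p → reindex j p)) (sym (*-distribˡ-sumTo (N ∸ j) _ _))) ⟩
    sumTo N (λ j → f j * sumTo (N ∸ j) (λ p → g p * h (N ∸ j ∸ p))) ∎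
    where
    reindex : ∀ j p → f j * g (j ℕ.+ p ∸ j) * h (N ∸ (j ℕ.+ p)) ≈ f j * (g p * h (N ∸ j ∸ p))
    reindex j p = trans (*-assoc _ _ _) (*-congˡ (*-cong (≡⇒≈ (P.cong g (ℕP.m+n∸m≡n j p)))
                                                        (≡⇒≈ (P.cong h (P.sym (ℕP.∸-+-assoc N j p))))))

  ⊛-identityˡ : ∀ f → onePS ⊛ f ≋ f
  ⊛-identityˡ f N = trans (sumTo-head N _ (λ i → zeroˡ _)) (*-identityˡ _)

  ⊛-·ʳ : ∀ x f g → f ⊛ (x · g) ≋ x · (f ⊛ g)
  ⊛-·ʳ x f g N = trans (sumTo-cong N (λ i → x∙yz≈y∙xz _ _ _)) (sym (*-distribˡ-sumTo N _ _))

  θ-onePS : ∀ N → θ onePS N ≈ 0#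
  θ-onePS zero = zeroˡ _
  θ-onePS (suc N) = zeroʳ _

  θ-⊛ : ∀ f g → θ (f ⊛ g) ≋ (λ N → (θ f ⊛ g) N + (f ⊛ θ g) N)
  θ-⊛ f g N = begin
    natR N * sumTo N (λ i → f i * g (N ∸ i))
      ≈⟨ *-distribˡ-sumTo N _ _ ⟩
    sumTo N (λ i → natR N * (f i * g (N ∸ i)))
      ≈⟨ sumTo-cong-≤ N leibniz ⟩
    sumTo N (λ i → natR i * f i * g (N ∸ i) + f i * (natR (N ∸ i) * g (N ∸ i)))
      ≈⟨ sumTo-+ N _ _ ⟩
    (θ f ⊛ g) N + (f ⊛ θ g) N ∎
    where
    leibniz : ∀ i → i ≤ N → natR N * (f i * g (N ∸ i)) ≈ natR i * f i * g (N ∸ i) + f i * (natR (N ∸ i) * g (N ∸ i))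
    leibniz i i≤N = begin
      natR N * (f i * g (N ∸ i))
        ≈⟨ *-congʳ (trans (≡⇒≈ (P.cong natR (P.sym (ℕP.m+[n∸m]≡n i≤N)))) (natR-+ i (N ∸ i))) ⟩
      (natR i + natR (N ∸ i)) * (f i * g (N ∸ i))
        ≈⟨ solve 4 (λ a b x y → (a :+ b) :* (x :* y) := a :* x :* y :+ x :* (b :* y)) refl _ _ _ _ ⟩
      natR i * f i * g (N ∸ i) + f i * (natR (N ∸ i) * g (N ∸ i)) ∎

  θ-powPS : ∀ f m → θ (powPS f (suc m)) ≋ natR (suc m) · (θ f ⊛ powPS f m)
  θ-powPS f zero N = begin
    θ (f ⊛ onePS) N                        ≈⟨ θ-⊛ f onePS N ⟩
    (θ f ⊛ onePS) N + (f ⊛ θ onePS) N      ≈⟨ +-congˡ (sumTo-zero N (λ i _ → trans (*-congˡ (θ-onePS (N ∸ i))) (zeroʳ _))) ⟩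
    (θ f ⊛ onePS) N + 0#                   ≈⟨ +-identityʳ _ ⟩
    (θ f ⊛ onePS) N                        ≈⟨ sym (trans (*-congʳ (+-identityʳ 1#)) (*-identityˡ _)) ⟩
    natR 1 * (θ f ⊛ onePS) N               ∎
  θ-powPS f (suc m) N = begin
    θ (f ⊛ fᵐ⁺¹) N                                      ≈⟨ θ-⊛ f fᵐ⁺¹ N ⟩
    (θ f ⊛ fᵐ⁺¹) N + (f ⊛ θ fᵐ⁺¹) N                     ≈⟨ +-congˡ (⊛-congˡ f (θ-powPS f m) N) ⟩
    (θ f ⊛ fᵐ⁺¹) N + (f ⊛ (natR (suc m) · (θ f ⊛ fᵐ))) N ≈⟨ +-congˡ (⊛-·ʳ (natR (suc m)) f (θ f ⊛ fᵐ) N) ⟩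
    (θ f ⊛ fᵐ⁺¹) N + natR (suc m) * (f ⊛ (θ f ⊛ fᵐ)) N   ≈⟨ +-congˡ (*-congˡ commute) ⟩
    (θ f ⊛ fᵐ⁺¹) N + natR (suc m) * (θ f ⊛ fᵐ⁺¹) N       ≈⟨ trans (+-congʳ (sym (*-identityˡ _))) (sym (distribʳ _ _ _)) ⟩
    (1# + natR (suc m)) * (θ f ⊛ fᵐ⁺¹) N                ∎
    where
    fᵐ fᵐ⁺¹ : PS
    fᵐ = powPS f m
    fᵐ⁺¹ = powPS f (suc m)
    commute : (f ⊛ (θ f ⊛ fᵐ)) N ≈ (θ f ⊛ fᵐ⁺¹) N
    commute = begin
      (f ⊛ (θ f ⊛ fᵐ)) N    ≈⟨ sym (⊛-assoc f (θ f) fᵐ N) ⟩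
      ((f ⊛ θ f) ⊛ fᵐ) N    ≈⟨ ⊛-cong {f′ = fᵐ} (⊛-comm f (θ f)) (λ _ → refl) N ⟩
      ((θ f ⊛ f) ⊛ fᵐ) N    ≈⟨ ⊛-assoc (θ f) f fᵐ N ⟩
      (θ f ⊛ fᵐ⁺¹) N        ∎

  powPS-+ : ∀ f m i → powPS f m ⊛ powPS f i ≋ powPS f (m ℕ.+ i)
  powPS-+ f zero i = ⊛-identityˡ (powPS f i)
  powPS-+ f (suc m) i N = begin
    ((f ⊛ powPS f m) ⊛ powPS f i) N   ≈⟨ ⊛-assoc f (powPS f m) (powPS f i) N ⟩
    (f ⊛ (powPS f m ⊛ powPS f i)) N   ≈⟨ ⊛-congˡ f (powPS-+ f m i) N ⟩
    (f ⊛ powPS f (m ℕ.+ i)) N         ∎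

S1-vanish : ∀ N m → N < m → S1 N m ≡ + 0
S1-vanish zero (suc m) _ = P.refl
S1-vanish (suc N) (suc m) (s≤s N<m)
  rewrite S1-vanish N m N<m | S1-vanish N (suc m) (ℕP.m≤n⇒m≤1+n N<m) | ℤP.*-zeroʳ (+ N) = P.refl

module Counting {c ℓ : Level} (R : CommutativeRing c ℓ) (inv : ℕ → CommutativeRing.Carrier R) where
  open CommutativeRing R
  open Setup R inv
  open Embedding R inv
  open Solver using (solve; _:*_; _:-_; :-_; _:=_)
  open Sums R inv
  open import Relation.Binary.Reasoning.Setoid setoid
  open import Algebra.Properties.Ring ring using (-‿distribˡ-*)

  pow-+ : ∀ y m n → pow y (m ℕ.+ n) ≈ pow y m * pow y n
  pow-+ y zero n = sym (*-identityˡ _)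
  pow-+ y (suc m) n = trans (*-congˡ (pow-+ y m n)) (sym (*-assoc _ _ _))

  sgn-+ : ∀ l j → sgn (l ℕ.+ j) ≈ sgn l * sgn j
  sgn-+ zero j = sym (*-identityˡ _)
  sgn-+ (suc l) j = trans (-‿cong (sgn-+ l j)) (-‿distribˡ-* _ _)

  pow-neg : ∀ y j → pow (- y) j ≈ sgn j * pow y j
  pow-neg y zero = sym (*-identityʳ _)
  pow-neg y (suc j) = trans (*-congˡ (pow-neg y j)) (solve 3 (λ y s p → (:- y) :* (s :* p) := (:- s) :* (y :* p)) refl _ _ _)

  C-vanish : ∀ {M j} → M < j → natR (M C j) ≈ 0#
  C-vanish M<j = ≡⇒≈ (P.cong natR (k>n⇒nCk≡0 M<j))

  stirling : ℕ → ℕ → Carrier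
  stirling N m = intR (S1 N m)

  stirling-vanish : ∀ {N m} → N < m → stirling N m ≈ 0#
  stirling-vanish {N} {m} N<m = ≡⇒≈ (P.cong intR (S1-vanish N m N<m))

  stirling-suc : ∀ N m → stirling (suc N) (suc m) ≈ stirling N m - natR N * stirling N (suc m)
  stirling-suc N m = begin
    intR (S1 N m ℤ.+ ℤ.- (+ N ℤ.* S1 N (suc m)))  ≈⟨ intR-+ (S1 N m) (ℤ.- (+ N ℤ.* S1 N (suc m))) ⟩
    stirling N m + intR (ℤ.- (+ N ℤ.* S1 N (suc m)))
      ≈⟨ +-congˡ (trans (intR-neg (+ N ℤ.* S1 N (suc m))) (-‿cong (intR-* (+ N) (S1 N (suc m))))) ⟩
    stirling N m - natR N * stirling N (suc m) ∎

  -- S1(N+1, 0) = 0, so the constant term of the expansion drops out.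
  stirling-sumTo-suc : ∀ N y → sumTo (suc N) (λ i → stirling (suc N) i * pow y i)
                              ≈ sumTo N (λ i → stirling (suc N) (suc i) * pow y (suc i))
  stirling-sumTo-suc N y = trans (sumTo-suc N _) (trans (+-congʳ (zeroˡ _)) (+-identityˡ _))

  natR*stirling-shift : ∀ N y → natR N * sumTo N (λ i → stirling N i * pow y i)
                               ≈ natR N * sumTo N (λ i → stirling N (suc i) * pow y (suc i))
  natR*stirling-shift zero y = trans (zeroˡ _) (sym (zeroˡ _))
  natR*stirling-shift (suc N) y = *-congˡ (begin
    sumTo (suc N) (λ i → stirling (suc N) i * pow y i)
      ≈⟨ stirling-sumTo-suc N y ⟩
    sumTo N (λ i → stirling (suc N) (suc i) * pow y (suc i))
      ≈⟨ sym (sumTo-extend N (suc N) _ (ℕP.n≤1+n N) vanish) ⟩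
    sumTo (suc N) (λ i → stirling (suc N) (suc i) * pow y (suc i)) ∎)
    where
    vanish : ∀ i → N < i → i ≤ suc N → stirling (suc N) (suc i) * pow y (suc i) ≈ 0#
    vanish i N<i _ = trans (*-congʳ (stirling-vanish (s≤s N<i))) (zeroˡ _)

  fall≈stirling : ∀ y N → fall y N ≈ sumTo N (λ i → stirling N i * pow y i)
  fall≈stirling y zero = sym (trans (*-identityʳ _) (+-identityʳ 1#))
  fall≈stirling y (suc N) = begin
    fall y N * (y - natR N)
      ≈⟨ *-congʳ (fall≈stirling y N) ⟩
    T * (y - natR N)
      ≈⟨ solve 3 (λ t y n → t :* (y :- n) := t :* y :- n :* t) refl T y (natR N) ⟩
    T * y - natR N * T
      ≈⟨ +-cong (*-distribʳ-sumTo N y _) (-‿cong (natR*stirling-shift N y)) ⟩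
    sumTo N (λ i → s N i * pow y i * y) - natR N * sumTo N (λ i → s N (suc i) * pow y (suc i))
      ≈⟨ +-congˡ (trans (-‿cong (*-distribˡ-sumTo N _ _)) (-‿sumTo N _)) ⟩
    sumTo N (λ i → s N i * pow y i * y) + sumTo N (λ i → - (natR N * (s N (suc i) * pow y (suc i))))
      ≈⟨ sym (sumTo-+ N _ _) ⟩
    sumTo N (λ i → s N i * pow y i * y - natR N * (s N (suc i) * pow y (suc i)))
      ≈⟨ sumTo-cong N (λ i → trans (regroup (s N i) (s N (suc i)) (pow y i) y (natR N)) (*-congʳ (sym (stirling-suc N i)))) ⟩
    sumTo N (λ i → s (suc N) (suc i) * pow y (suc i))
      ≈⟨ sym (stirling-sumTo-suc N y) ⟩
    sumTo (suc N) (λ i → s (suc N) i * pow y i) ∎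
    where
    s : ℕ → ℕ → Carrier
    s = stirling
    T : Carrier
    T = sumTo N (λ i → s N i * pow y i)
    regroup : ∀ u v p y n → u * p * y - n * (v * (y * p)) ≈ (u - n * v) * (y * p)
    regroup = solve 5 (λ u v p y n → u :* p :* y :- n :* (v :* (y :* p)) := (u :- n :* v) :* (y :* p)) refl

module Factorials {c ℓ : Level} (R : CommutativeRing c ℓ) (inv : ℕ → CommutativeRing.Carrier R)
  (inv-correct : ∀ m → CommutativeRing._≈_ R (CommutativeRing._*_ R (Setup.natR R inv (suc m)) (inv m)) (CommutativeRing.1# R)) where
  open CommutativeRing R
  open Setup R inv
  open Embedding R inv
  open Solver using (solve; _:*_; _:=_)
  open import Relation.Binary.Reasoning.Setoid setoid

  natR-!*invFact : ∀ m → natR (m ℕ.!) * invFact m ≈ 1#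
  natR-!*invFact zero = trans (*-identityʳ _) (+-identityʳ 1#)
  natR-!*invFact (suc m) = begin
    natR (suc m ℕ.* m ℕ.!) * (inv m * invFact m)
      ≈⟨ *-congʳ (natR-* (suc m) (m ℕ.!)) ⟩
    natR (suc m) * natR (m ℕ.!) * (inv m * invFact m)
      ≈⟨ solve 4 (λ n f i j → n :* f :* (i :* j) := (n :* i) :* (f :* j)) refl _ _ _ _ ⟩
    (natR (suc m) * inv m) * (natR (m ℕ.!) * invFact m)
      ≈⟨ *-cong (inv-correct m) (natR-!*invFact m) ⟩
    1# * 1#
      ≈⟨ *-identityʳ _ ⟩
    1# ∎

  natR-C : ∀ {M j} → j ≤ M → natR (M ℕ.!) * invFact j * invFact (M ∸ j) ≈ natR (M C j)
  natR-C {M} {j} j≤M = begin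
    natR (M ℕ.!) * invFact j * invFact (M ∸ j)
      ≈⟨ *-congʳ (*-congʳ (≡⇒≈ (P.cong natR (P.sym M!≡MCj*j!*[M∸j]!)))) ⟩
    natR ((M C j) ℕ.* (j ℕ.! ℕ.* (M ∸ j) ℕ.!)) * invFact j * invFact (M ∸ j)
      ≈⟨ *-congʳ (*-congʳ (trans (natR-* (M C j) _) (*-congˡ (natR-* (j ℕ.!) ((M ∸ j) ℕ.!))))) ⟩
    natR (M C j) * (natR (j ℕ.!) * natR ((M ∸ j) ℕ.!)) * invFact j * invFact (M ∸ j)
      ≈⟨ solve 5 (λ c f g i k → c :* (f :* g) :* i :* k := c :* ((f :* i) :* (g :* k))) refl _ _ _ _ _ ⟩
    natR (M C j) * ((natR (j ℕ.!) * invFact j) * (natR ((M ∸ j) ℕ.!) * invFact (M ∸ j)))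
      ≈⟨ *-congˡ (trans (*-cong (natR-!*invFact j) (natR-!*invFact (M ∸ j))) (*-identityʳ _)) ⟩
    natR (M C j) * 1#
      ≈⟨ *-identityʳ _ ⟩
    natR (M C j) ∎
    where
    M!≡MCj*j!*[M∸j]! : (M C j) ℕ.* (j ℕ.! ℕ.* (M ∸ j) ℕ.!) ≡ M ℕ.!
    M!≡MCj*j!*[M∸j]! = P.trans (P.cong (ℕ._* (j ℕ.! ℕ.* (M ∸ j) ℕ.!)) (nCk≡n!/k![n-k]! j≤M))
                               (m/n*n≡m {{ℕP._!*_!≢0 j (M ∸ j)}} (k![n∸k]!∣n! j≤M))

module Logarithm {c ℓ : Level} (R : CommutativeRing c ℓ) (inv : ℕ → CommutativeRing.Carrier R)
  (inv-correct : ∀ m → CommutativeRing._≈_ R (CommutativeRing._*_ R (Setup.natR R inv (suc m)) (inv m)) (CommutativeRing.1# R))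
  (ainv : CommutativeRing.Carrier R) where
  open CommutativeRing R
  open Setup R inv
  open Embedding R inv
  open Solver using (solve; _:+_; _:*_; _:-_; :-_; _:=_; con)
  open Sums R inv
  open Series R inv
  open Counting R inv
  open import Relation.Binary.Reasoning.Setoid setoid

  L : PS
  L = log1p ainv

  θL-suc : ∀ i → θ L (suc i) ≈ sgn i * pow ainv (suc i)
  θL-suc i = begin
    natR (suc i) * (sgn i * inv i * pow ainv (suc i))
      ≈⟨ solve 4 (λ n s v p → n :* (s :* v :* p) := (n :* v) :* (s :* p)) refl _ _ _ _ ⟩
    (natR (suc i) * inv i) * (sgn i * pow ainv (suc i))
      ≈⟨ trans (*-congʳ (inv-correct i)) (*-identityˡ _) ⟩
    sgn i * pow ainv (suc i) ∎

  -- (1 + t/a) θL = t/a, read off coefficientwise after convolving with Y.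
  θL-⊛ : ∀ Y N → (θ L ⊛ Y) (suc N) + ainv * (θ L ⊛ Y) N ≈ ainv * Y N
  θL-⊛ Y N = begin
    sumTo (suc N) (λ i → θ L i * Y (suc N ∸ i)) + ainv * sumTo N (λ i → θ L i * Y (N ∸ i))
      ≈⟨ +-cong (sumTo-suc N _) (*-distribˡ-sumTo N _ _) ⟩
    (θ L 0 * Y (suc N) + sumTo N (λ i → θ L (suc i) * Y (N ∸ i))) + sumTo N (λ i → ainv * (θ L i * Y (N ∸ i)))
      ≈⟨ +-congʳ (trans (+-congʳ (trans (*-congʳ (zeroʳ _)) (zeroˡ _))) (+-identityˡ _)) ⟩
    sumTo N (λ i → θ L (suc i) * Y (N ∸ i)) + sumTo N (λ i → ainv * (θ L i * Y (N ∸ i)))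
      ≈⟨ sym (sumTo-+ N _ _) ⟩
    sumTo N (λ i → θ L (suc i) * Y (N ∸ i) + ainv * (θ L i * Y (N ∸ i)))
      ≈⟨ sumTo-cong N (λ i → solve 4 (λ u v w y → u :* y :+ w :* (v :* y) := (u :+ w :* v) :* y) refl _ _ _ _) ⟩
    sumTo N (λ i → (θ L (suc i) + ainv * θ L i) * Y (N ∸ i))
      ≈⟨ sumTo-head N _ (λ i → trans (*-congʳ (telescope i)) (zeroˡ _)) ⟩
    (θ L 1 + ainv * θ L 0) * Y N
      ≈⟨ *-congʳ (trans (+-cong (θL-suc 0) (trans (*-congˡ (zeroʳ _)) (zeroʳ _)))
                        (trans (+-identityʳ _) (trans (*-identityˡ _) (*-identityʳ _)))) ⟩
    ainv * Y N ∎
    where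
    telescope : ∀ i → θ L (suc (suc i)) + ainv * θ L (suc i) ≈ 0#
    telescope i = begin
      θ L (suc (suc i)) + ainv * θ L (suc i)
        ≈⟨ +-cong (θL-suc (suc i)) (*-congˡ (θL-suc i)) ⟩
      - sgn i * (ainv * pow ainv (suc i)) + ainv * (sgn i * pow ainv (suc i))
        ≈⟨ solve 3 (λ s v p → (:- s) :* (v :* p) :+ v :* (s :* p) := con (+ 0)) refl _ _ _ ⟩
      0# ∎

  powL-recurrence : ∀ m N → natR (suc N) * powPS L (suc m) (suc N) + ainv * (natR N * powPS L (suc m) N)
                            ≈ natR (suc m) * (ainv * powPS L m N)
  powL-recurrence m N = begin
    θ (powPS L (suc m)) (suc N) + ainv * θ (powPS L (suc m)) N
      ≈⟨ +-cong (θ-powPS L m (suc N)) (*-congˡ (θ-powPS L m N)) ⟩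
    natR (suc m) * (θ L ⊛ powPS L m) (suc N) + ainv * (natR (suc m) * (θ L ⊛ powPS L m) N)
      ≈⟨ solve 4 (λ n u v w → n :* u :+ w :* (n :* v) := n :* (u :+ w :* v)) refl _ _ _ _ ⟩
    natR (suc m) * ((θ L ⊛ powPS L m) (suc N) + ainv * (θ L ⊛ powPS L m) N)
      ≈⟨ *-congˡ (θL-⊛ (powPS L m) N) ⟩
    natR (suc m) * (ainv * powPS L m N) ∎

  -- the coefficients of L^m, i.e. L^m / m! = Σ_N S1(N,m) (t/a)^N / N!
  stirlingSeries : ℕ → PS
  stirlingSeries m N = natR (m ℕ.!) * invFact N * stirling N m * pow ainv N

  stirlingSeries-vanish : ∀ {m N} → N < m → stirlingSeries m N ≈ 0#
  stirlingSeries-vanish N<m = trans (*-congʳ (trans (*-congˡ (stirling-vanish N<m)) (zeroʳ _))) (zeroˡ _)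

  powL≋stirlingSeries : ∀ m → powPS L m ≋ stirlingSeries m
  powL≋stirlingSeries zero zero = sym (trans (*-identityʳ _) (trans (*-congʳ (*-identityʳ _))
                                        (trans (*-cong (+-identityʳ 1#) (+-identityʳ 1#)) (*-identityʳ _))))
  powL≋stirlingSeries zero (suc N) = sym (trans (*-congʳ (zeroʳ _)) (zeroˡ _))
  powL≋stirlingSeries (suc m) zero = trans (zeroˡ _) (sym (stirlingSeries-vanish {suc m} (s≤s z≤n)))
  powL≋stirlingSeries (suc m) (suc N) = begin
    X
      ≈⟨ sym (trans (sym (*-assoc _ _ _)) (trans (*-congʳ (trans (*-comm _ _) (inv-correct N))) (*-identityˡ _))) ⟩
    inv N * (natR (suc N) * X)
      ≈⟨ *-congˡ (sym (//-rightDividesʳ _ _)) ⟩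
    inv N * ((natR (suc N) * X + ainv * (nN * powPS L (suc m) N)) - ainv * (nN * powPS L (suc m) N))
      ≈⟨ *-congˡ (+-cong (powL-recurrence m N) (-‿cong (*-congˡ (*-congˡ (powL≋stirlingSeries (suc m) N))))) ⟩
    inv N * (A * (ainv * powPS L m N) - ainv * (nN * stirlingSeries (suc m) N))
      ≈⟨ *-congˡ (+-cong (*-congˡ (*-congˡ (powL≋stirlingSeries m N)))
                          (-‿cong (*-congˡ (*-congˡ (*-congʳ (*-congʳ (*-congʳ (natR-* (suc m) (m ℕ.!))))))))) ⟩
    inv N * (A * (ainv * (F * J * u * p)) - ainv * (nN * (A * F * J * v * p)))
      ≈⟨ solve 9 (λ A F I J a p u v n → I :* (A :* (a :* (F :* J :* u :* p)) :- a :* (n :* (A :* F :* J :* v :* p)))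
                                        := A :* F :* (I :* J) :* (u :- n :* v) :* (a :* p)) refl A F (inv N) J ainv p u v nN ⟩
    A * F * (inv N * J) * (u - nN * v) * (ainv * p)
      ≈⟨ *-congʳ (*-cong (*-congʳ (sym (natR-* (suc m) (m ℕ.!)))) (sym (stirling-suc N m))) ⟩
    stirlingSeries (suc m) (suc N) ∎
    where
    open import Algebra.Properties.Group +-group using (//-rightDividesʳ)
    X A F J p u v nN : Carrier
    X = powPS L (suc m) (suc N)
    A = natR (suc m)
    F = natR (m ℕ.!)
    J = invFact N
    p = pow ainv N
    u = stirling N m
    v = stirling N (suc m)
    nN = natR N

  powL-vanish : ∀ {m N} → N < m → powPS L m N ≈ 0#
  powL-vanish {m} {N} N<m = trans (powL≋stirlingSeries m N) (stirlingSeries-vanish N<m)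

module Product {c ℓ : Level} (R : CommutativeRing c ℓ) (inv : ℕ → CommutativeRing.Carrier R)
  (inv-correct : ∀ m → CommutativeRing._≈_ R (CommutativeRing._*_ R (Setup.natR R inv (suc m)) (inv m)) (CommutativeRing.1# R))
  (ainv : CommutativeRing.Carrier R) (k : ℤ) (x : CommutativeRing.Carrier R) where
  open CommutativeRing R
  open Setup R inv
  open Embedding R inv
  open Solver using (solve; _:*_; _:=_)
  open Sums R inv
  open Series R inv
  open Counting R inv
  open Factorials R inv inv-correct
  open Logarithm R inv inv-correct ainv
  open import Relation.Binary.Reasoning.Setoid setoid

  -- (1 + t/a)^{-x} = exp(-x L), with coefficients (-x)^i / i!
  expCoeff : ℕ → Carrier
  expCoeff i = pow (- x) i * invFact i

  binomNeg≈sumTo-powL : ∀ M N → M ≤ N → binomNeg ainv x M ≈ sumTo N (λ i → expCoeff i * powPS L i M)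
  binomNeg≈sumTo-powL M N M≤N = begin
    fall (- x) M * invFact M * pow ainv M
      ≈⟨ *-congʳ (*-congʳ (fall≈stirling (- x) M)) ⟩
    sumTo M (λ i → stirling M i * pow (- x) i) * invFact M * pow ainv M
      ≈⟨ trans (*-congʳ (*-distribʳ-sumTo M _ _)) (*-distribʳ-sumTo M _ _) ⟩
    sumTo M (λ i → stirling M i * pow (- x) i * invFact M * pow ainv M)
      ≈⟨ sumTo-cong M term ⟩
    sumTo M (λ i → expCoeff i * powPS L i M)
      ≈⟨ sym (sumTo-extend M N _ M≤N (λ i M<i _ → trans (*-congˡ (powL-vanish M<i)) (zeroʳ _))) ⟩
    sumTo N (λ i → expCoeff i * powPS L i M) ∎
    where
    term : ∀ i → stirling M i * pow (- x) i * invFact M * pow ainv M ≈ expCoeff i * powPS L i M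
    term i = begin
      stirling M i * pow (- x) i * invFact M * pow ainv M
        ≈⟨ sym (trans (*-congʳ (natR-!*invFact i)) (*-identityˡ _)) ⟩
      natR (i ℕ.!) * invFact i * (stirling M i * pow (- x) i * invFact M * pow ainv M)
        ≈⟨ solve 6 (λ f fi u X J q → f :* fi :* (u :* X :* J :* q) := X :* fi :* (f :* J :* u :* q)) refl _ _ _ _ _ _ ⟩
      expCoeff i * stirlingSeries i M
        ≈⟨ *-congˡ (sym (powL≋stirlingSeries i M)) ⟩
      expCoeff i * powPS L i M ∎

  LifComp≈sumTo-powL : ∀ p N → p ≤ N → LifComp k L p ≈ sumTo N (λ m → powPS L m p * invFact m * invPowZ m k)
  LifComp≈sumTo-powL p N p≤N =
    sym (sumTo-extend p N _ p≤N (λ m p<m _ → trans (*-congʳ (trans (*-congʳ (powL-vanish p<m)) (zeroˡ _))) (zeroˡ _)))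

  -- the j-th summand of Σ_{m+i=M} M!/(m! i!) (-x)^i / (m+1)^k
  W-term : ℕ → ℕ → Carrier
  W-term M j = natR (M C j) * sgn j * pow x j * invPowZ (M ∸ j) k

  W-term-vanish : ∀ {M j} → M < j → W-term M j ≈ 0#
  W-term-vanish M<j = trans (*-congʳ (*-congʳ (trans (*-congʳ (C-vanish M<j)) (zeroˡ _)))) (trans (*-congʳ (zeroˡ _)) (zeroˡ _))

  Q : PS
  Q N = invFact N * pow ainv N * sumTo N (λ M → stirling N M * sumTo M (W-term M))

  LifComp⊛binomNeg : LifComp k L ⊛ binomNeg ainv x ≋ Q
  LifComp⊛binomNeg N = begin
    sumTo N (λ p → LifComp k L p * binomNeg ainv x (N ∸ p))
      ≈⟨ sumTo-cong-≤ N (λ p p≤N → *-cong (LifComp≈sumTo-powL p N p≤N) (binomNeg≈sumTo-powL (N ∸ p) N (ℕP.m∸n≤m N p))) ⟩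
    sumTo N (λ p → sumTo N (λ m → α m p) * sumTo N (λ i → β i (N ∸ p)))
      ≈⟨ sumTo-cong N (λ p → trans (*-distribʳ-sumTo N _ _) (sumTo-cong N (λ m → *-distribˡ-sumTo N _ _))) ⟩
    sumTo N (λ p → sumTo N (λ m → sumTo N (λ i → α m p * β i (N ∸ p))))
      ≈⟨ trans (sumTo-swap N N _) (sumTo-cong N (λ m → sumTo-swap N N _)) ⟩
    sumTo N (λ m → sumTo N (λ i → sumTo N (λ p → α m p * β i (N ∸ p))))
      ≈⟨ sumTo-cong N (λ m → sumTo-cong N (λ i → convolve m i)) ⟩
    sumTo N (λ m → sumTo N (λ i → F m i))
      ≈⟨ sumTo-antidiagonal N F F-vanish ⟩
    sumTo N (λ M → sumTo M (λ j → F (M ∸ j) j))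
      ≈⟨ sumTo-cong N (λ M → sumTo-cong-≤ M (λ j j≤M → F-antidiagonal M j j≤M)) ⟩
    sumTo N (λ M → sumTo M (λ j → invFact N * pow ainv N * (stirling N M * W-term M j)))
      ≈⟨ sumTo-cong N (λ M → trans (sym (*-distribˡ-sumTo M _ _)) (*-congˡ (sym (*-distribˡ-sumTo M _ _)))) ⟩
    sumTo N (λ M → invFact N * pow ainv N * (stirling N M * sumTo M (W-term M)))
      ≈⟨ sym (*-distribˡ-sumTo N _ _) ⟩
    Q N ∎
    where
    α : ℕ → ℕ → Carrier
    α m p = powPS L m p * invFact m * invPowZ m k
    β : ℕ → ℕ → Carrier
    β i q = expCoeff i * powPS L i q

    F : ℕ → ℕ → Carrier
    F m i = (invFact m * invPowZ m k * expCoeff i) * stirlingSeries (m ℕ.+ i) N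

    convolve : ∀ m i → sumTo N (λ p → α m p * β i (N ∸ p)) ≈ F m i
    convolve m i = begin
      sumTo N (λ p → α m p * β i (N ∸ p))
        ≈⟨ sumTo-cong N (λ p → solve 5 (λ u f z c v → (u :* f :* z) :* (c :* v) := (f :* z :* c) :* (u :* v)) refl _ _ _ _ _) ⟩
      sumTo N (λ p → (invFact m * invPowZ m k * expCoeff i) * (powPS L m p * powPS L i (N ∸ p)))
        ≈⟨ sym (*-distribˡ-sumTo N _ _) ⟩
      (invFact m * invPowZ m k * expCoeff i) * (powPS L m ⊛ powPS L i) N
        ≈⟨ *-congˡ (trans (powPS-+ L m i N) (powL≋stirlingSeries (m ℕ.+ i) N)) ⟩
      F m i ∎

    F-vanish : ∀ m i → i ≤ N → N ∸ i < m → F m i ≈ 0#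
    F-vanish m i i≤N N∸i<m = trans (*-congˡ (stirlingSeries-vanish N<m+i)) (zeroʳ _)
      where
      N<m+i : N < m ℕ.+ i
      N<m+i = P.subst (ℕ._< m ℕ.+ i) (ℕP.m∸n+n≡m i≤N) (ℕP.+-monoˡ-< i N∸i<m)

    F-antidiagonal : ∀ M j → j ≤ M → F (M ∸ j) j ≈ invFact N * pow ainv N * (stirling N M * W-term M j)
    F-antidiagonal M j j≤M = begin
      (invFact (M ∸ j) * invPowZ (M ∸ j) k * (pow (- x) j * invFact j)) * stirlingSeries (M ∸ j ℕ.+ j) N
        ≈⟨ *-cong (*-congˡ (*-congʳ (pow-neg x j))) (≡⇒≈ (P.cong (λ z → stirlingSeries z N) (ℕP.m∸n+n≡m j≤M))) ⟩
      (invFact (M ∸ j) * invPowZ (M ∸ j) k * (sgn j * pow x j * invFact j)) * (natR (M ℕ.!) * invFact N * stirling N M * pow ainv N)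
        ≈⟨ solve 9 (λ a z sg px b f J u q → (a :* z :* (sg :* px :* b)) :* (f :* J :* u :* q)
                                            := (f :* b :* a) :* (J :* q :* (u :* (sg :* px :* z)))) refl
              (invFact (M ∸ j)) (invPowZ (M ∸ j) k) (sgn j) (pow x j) (invFact j) (natR (M ℕ.!)) (invFact N) (stirling N M) (pow ainv N) ⟩
      (natR (M ℕ.!) * invFact j * invFact (M ∸ j)) * (invFact N * pow ainv N * (stirling N M * (sgn j * pow x j * invPowZ (M ∸ j) k)))
        ≈⟨ *-congʳ (natR-C j≤M) ⟩
      natR (M C j) * (invFact N * pow ainv N * (stirling N M * (sgn j * pow x j * invPowZ (M ∸ j) k)))
        ≈⟨ solve 7 (λ c J q u sg px z → c :* (J :* q :* (u :* (sg :* px :* z))) := J :* q :* (u :* (c :* sg :* px :* z))) refl _ _ _ _ _ _ _ ⟩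
      invFact N * pow ainv N * (stirling N M * W-term M j) ∎

module Coefficients {c ℓ : Level} (R : CommutativeRing c ℓ) (inv : ℕ → CommutativeRing.Carrier R)
  (inv-correct : ∀ m → CommutativeRing._≈_ R (CommutativeRing._*_ R (Setup.natR R inv (suc m)) (inv m)) (CommutativeRing.1# R))
  (a ainv : CommutativeRing.Carrier R)
  (a*ainv≈1 : CommutativeRing._≈_ R (CommutativeRing._*_ R a ainv) (CommutativeRing.1# R))
  (k : ℤ) (x : CommutativeRing.Carrier R) where
  open CommutativeRing R
  open Setup R inv
  open Embedding R inv
  open Solver using (solve; _:*_; _:=_)
  open Sums R inv
  open Series R inv
  open Counting R inv
  open Factorials R inv inv-correct
  open Logarithm R inv inv-correct ainv
  open Product R inv inv-correct ainv k x
  open import Relation.Binary.Reasoning.Setoid setoid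

  powAinv*powA : ∀ l → pow ainv l * pow a l ≈ 1#
  powAinv*powA zero = *-identityʳ _
  powAinv*powA (suc l) = begin
    ainv * pow ainv l * (a * pow a l)   ≈⟨ solve 4 (λ v p w q → v :* p :* (w :* q) := (w :* v) :* (p :* q)) refl _ _ _ _ ⟩
    (a * ainv) * (pow ainv l * pow a l) ≈⟨ *-cong a*ainv≈1 (powAinv*powA l) ⟩
    1# * 1#                             ≈⟨ *-identityʳ _ ⟩
    1#                                  ∎

  V : ℕ → ℕ → ℕ → ℕ → Carrier
  V n l m j = pow ainv n * (sgn (l ℕ.+ j) * natR (n C l) * natR (m C j) * pow a l * invPowZ (m ∸ j) k
                            * intR (S1 (n ∸ l) m) * pow x j)

  RHS≈sumTo₃ : ∀ n → RHS k a ainv n x ≈ sumTo n (λ j → sumTo n (λ m → sumTo n (λ l → V n l m j)))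
  RHS≈sumTo₃ n = begin
    pow ainv n * sumTo n (λ j → sumFromTo j n (λ m → sumTo (n ∸ m) (λ l → T l m j)) * pow x j)
      ≈⟨ *-congˡ (sumTo-cong n (λ j → *-congʳ (trans (sumFromTo≈sumTo j n _ (m<j-vanish j))
                                                     (sumTo-cong-≤ n (λ m m≤n → sym (sumTo-extend (n ∸ m) n _ (ℕP.m∸n≤m n m) (l-vanish m j m≤n))))))) ⟩
    pow ainv n * sumTo n (λ j → sumTo n (λ m → sumTo n (λ l → T l m j)) * pow x j)
      ≈⟨ *-distribˡ-sumTo n _ _ ⟩
    sumTo n (λ j → pow ainv n * (sumTo n (λ m → sumTo n (λ l → T l m j)) * pow x j))
      ≈⟨ sumTo-cong n (λ j → *-congˡ (trans (*-distribʳ-sumTo n _ _) (sumTo-cong n (λ m → *-distribʳ-sumTo n _ _)))) ⟩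
    sumTo n (λ j → pow ainv n * sumTo n (λ m → sumTo n (λ l → T l m j * pow x j)))
      ≈⟨ sumTo-cong n (λ j → trans (*-distribˡ-sumTo n _ _) (sumTo-cong n (λ m → *-distribˡ-sumTo n _ _))) ⟩
    sumTo n (λ j → sumTo n (λ m → sumTo n (λ l → V n l m j))) ∎
    where
    T : ℕ → ℕ → ℕ → Carrier
    T l m j = sgn (l ℕ.+ j) * natR (n C l) * natR (m C j) * pow a l * invPowZ (m ∸ j) k * intR (S1 (n ∸ l) m)

    m<j-vanish : ∀ j m → m < j → sumTo (n ∸ m) (λ l → T l m j) ≈ 0#
    m<j-vanish j m m<j = sumTo-zero (n ∸ m) (λ l _ →
      trans (*-congʳ (*-congʳ (*-congʳ (trans (*-congˡ (C-vanish m<j)) (zeroʳ _)))))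
            (trans (*-congʳ (*-congʳ (zeroˡ _))) (trans (*-congʳ (zeroˡ _)) (zeroˡ _))))

    l-vanish : ∀ m j → m ≤ n → ∀ l → n ∸ m < l → l ≤ n → T l m j ≈ 0#
    l-vanish m j m≤n l n∸m<l l≤n = trans (*-congˡ (stirling-vanish n∸l<m)) (zeroʳ _)
      where
      n∸l<m : n ∸ l < m
      n∸l<m = P.subst (n ∸ l <_) (ℕP.m∸[m∸n]≡n m≤n) (ℕP.∸-monoʳ-< n∸m<l l≤n)

  PC-summand : ∀ n l → l ≤ n → natR (n ℕ.!) * (expNeg l * Q (n ∸ l)) ≈ sumTo n (λ m → sumTo n (λ j → V n l m j))
  PC-summand n l l≤n = begin
    natR (n ℕ.!) * (sgn l * invFact l * (invFact n-l * pow ainv n-l * Σ))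
      ≈⟨ solve 6 (λ f sg il inl q S → f :* (sg :* il :* (inl :* q :* S)) := (f :* il :* inl) :* (sg :* q :* S)) refl _ _ _ _ _ _ ⟩
    (natR (n ℕ.!) * invFact l * invFact n-l) * (sgn l * pow ainv n-l * Σ)
      ≈⟨ *-congʳ (natR-C l≤n) ⟩
    natR (n C l) * (sgn l * pow ainv n-l * Σ)
      ≈⟨ solve 4 (λ c sg q S → c :* (sg :* q :* S) := (c :* (sg :* q)) :* S) refl _ _ _ _ ⟩
    K * Σ
      ≈⟨ trans (*-distribˡ-sumTo n-l _ _) (sumTo-cong n-l (λ M → trans (*-congˡ (*-distribˡ-sumTo M _ _)) (*-distribˡ-sumTo M _ _))) ⟩
    sumTo n-l (λ M → sumTo M (λ j → K * (stirling n-l M * W-term M j)))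
      ≈⟨ sumTo-cong-≤ n-l (λ M M≤n-l → sym (sumTo-extend M n _ (ℕP.≤-trans M≤n-l (ℕP.m∸n≤m n l))
                                                 (λ j M<j _ → trans (*-congˡ (trans (*-congˡ (W-term-vanish M<j)) (zeroʳ _))) (zeroʳ _)))) ⟩
    sumTo n-l (λ M → sumTo n (λ j → K * (stirling n-l M * W-term M j)))
      ≈⟨ sym (sumTo-extend n-l n _ (ℕP.m∸n≤m n l)
                (λ M n-l<M _ → sumTo-zero n (λ j _ → trans (*-congˡ (trans (*-congʳ (stirling-vanish n-l<M)) (zeroˡ _))) (zeroʳ _)))) ⟩
    sumTo n (λ M → sumTo n (λ j → K * (stirling n-l M * W-term M j)))
      ≈⟨ sumTo-cong n (λ M → sumTo-cong n (λ j → sym (V≈ M j))) ⟩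
    sumTo n (λ m → sumTo n (λ j → V n l m j)) ∎
    where
    n-l : ℕ
    n-l = n ∸ l
    Σ K : Carrier
    Σ = sumTo n-l (λ M → stirling n-l M * sumTo M (W-term M))
    K = natR (n C l) * (sgn l * pow ainv n-l)

    V≈ : ∀ M j → V n l M j ≈ K * (stirling n-l M * W-term M j)
    V≈ M j = begin
      V n l M j
        ≈⟨ *-cong (trans (≡⇒≈ (P.cong (pow ainv) (P.sym (ℕP.m∸n+n≡m l≤n)))) (pow-+ ainv n-l l))
                  (*-congʳ (*-congʳ (*-congʳ (*-congʳ (*-congʳ (*-congʳ (sgn-+ l j))))))) ⟩
      (pow ainv n-l * pow ainv l) * (sgn l * sgn j * natR (n C l) * natR (M C j) * pow a l * invPowZ (M ∸ j) k * stirling n-l M * pow x j)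
        ≈⟨ solve 10 (λ q r sl sj cn cm pa z u px → (q :* r) :* (sl :* sj :* cn :* cm :* pa :* z :* u :* px)
                                                   := (r :* pa) :* ((cn :* (sl :* q)) :* (u :* (cm :* sj :* px :* z)))) refl
             (pow ainv n-l) (pow ainv l) (sgn l) (sgn j) (natR (n C l)) (natR (M C j)) (pow a l) (invPowZ (M ∸ j) k) (stirling n-l M) (pow x j) ⟩
      (pow ainv l * pow a l) * (K * (stirling n-l M * W-term M j))
        ≈⟨ trans (*-congʳ (powAinv*powA l)) (*-identityˡ _) ⟩
      K * (stirling n-l M * W-term M j) ∎

  PC≈sumTo₃ : ∀ n → PC k ainv n x ≈ sumTo n (λ l → sumTo n (λ m → sumTo n (λ j → V n l m j)))
  PC≈sumTo₃ n = begin
    natR (n ℕ.!) * ((expNeg ⊛ LifComp k L) ⊛ binomNeg ainv x) n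
      ≈⟨ *-congˡ (trans (⊛-assoc expNeg (LifComp k L) (binomNeg ainv x) n) (⊛-congˡ expNeg LifComp⊛binomNeg n)) ⟩
    natR (n ℕ.!) * sumTo n (λ l → expNeg l * Q (n ∸ l))
      ≈⟨ trans (*-distribˡ-sumTo n _ _) (sumTo-cong-≤ n (PC-summand n)) ⟩
    sumTo n (λ l → sumTo n (λ m → sumTo n (λ j → V n l m j))) ∎

theorem3 : ∀ {c ℓ : Level} (R : CommutativeRing c ℓ)
    (inv : ℕ → CommutativeRing.Carrier R) →
    (∀ m → CommutativeRing._≈_ R (CommutativeRing._*_ R (Setup.natR R inv (suc m)) (inv m)) (CommutativeRing.1# R)) →
    (a ainv : CommutativeRing.Carrier R) →
    CommutativeRing._≈_ R (CommutativeRing._*_ R a ainv) (CommutativeRing.1# R) →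
    (k : ℤ) (n : ℕ) (x : CommutativeRing.Carrier R) →
    CommutativeRing._≈_ R (Setup.PC R inv k ainv n x) (Setup.RHS R inv k a ainv n x)
theorem3 R inv inv-correct a ainv a*ainv≈1 k n x = begin
  PC k ainv n x                                               ≈⟨ PC≈sumTo₃ n ⟩
  sumTo n (λ l → sumTo n (λ m → sumTo n (λ j → V n l m j))) ≈⟨ sumTo-swap₃ n (V n) ⟩
  sumTo n (λ j → sumTo n (λ m → sumTo n (λ l → V n l m j))) ≈⟨ sym (RHS≈sumTo₃ n) ⟩
  RHS k a ainv n x                                            ∎
  where
  open CommutativeRing R using (setoid; sym)
  open Setup R inv using (PC; RHS; sumTo)
  open Sums R inv using (sumTo-swap₃)
  open Coefficients R inv inv-correct a ainv a*ainv≈1 k x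
  open import Relation.Binary.Reasoning.Setoid setoid
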